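{- Let $X,Y,Z$ be finite sets and let $T\subseteq X\times Y\times Z$ be a nonempty relation such that for every $(x,y)\in X\times Y$ there exists $z\in Z$ with $(x,y,z)\in T$. Let $\mathcal{M}'\subseteq\mathcal{M}(T)$ be a set of pairwise disjoint monochromatic rectangles which recursively partitions $M_T$. Define $x\in\mathbb{N}^{\mathcal{M}(T)}$ by $x_R=1$ if $R\in\mathcal{M}'$ and $x_R=0$ otherwise. Then $x$ is feasible to $\mathbf{PN}(T)$, i.e., there exists $y\in\mathbb{N}^{\Gamma(T)}$ such that $(x,y)$ satisfies constraints (i) and (ii) of $\mathbf{PN}(T)$.
   Context: The communication matrix $M_T$ has rows indexed by $X$ and columns by $Y$; its cell set is $C_T=X\times Y$. A rectangle is a nonempty product $X'\times Y'\subseteq X\times Y$ (with $X',Y'$ nonempty); $\mathcal{R}(T)$ denotes the set of all rectangles and $\mathcal{R}^{\ast}(T)=\mathcal{R}(T)\setminus\{C_T\}$. A rectangle $X'\times Y'$ is monochromatic if there is $z\in Z$ with $(x,y,z)\in T$ for all $(x,y)\in X'\times Y'$; $\mathcal{M}(T)$ denotes the set of monochromatic rectangles. A partition of a rectangle $X'\times Y'$ is an unordered pair of rectangles $\{X'_1\times Y',X'_2\times Y'\}$ with $X'=X'_1\cup X'_2$, $X'_1\cap X'_2=\emptyset$, or $\{X'\times Y'_1,X'\times Y'_2\}$ with $Y'=Y'_1\cup Y'_2$, $Y'_1\cap Y'_2=\emptyset$; $\mathcal{P}(R)$ is the set of partitions of $R$, and for $P\in\mathcal{P}(R)$ we write $V\in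 P$ if $V$ is one of the two rectangles of $P$. Let $\Gamma(T)=\{(R,P): R\in\mathcal{R}(T),\ P\in\mathcal{P}(R)\}$. A set $\mathcal{R}$ of pairwise disjoint rectangles recursively partitions $M_T$ if its union is $C_T$ and there is a rooted binary tree whose vertices correspond to rectangles, whose root corresponds to $C_T$, whose leaves correspond exactly to the rectangles of $\mathcal{R}$, and such that for each non-leaf vertex the rectangles of its two children form a partition of the rectangle of that vertex. The integer program $\mathbf{PN}(T)$ has variables $x\in\mathbb{N}^{\mathcal{M}(T)}$, $y\in\mathbb{N}^{\Gamma(T)}$ ($\mathbb{N}$ the nonnegative integers) and asks to minimize $\sum_{R\in\mathcal{M}(T)}x_R$ subject to (i) $\sum_{R\in\mathcal{M}(T):\,c\in R}x_R=1$ for every $c\in C_T$, and (ii) for every $R\in\mathcal{R}^{\ast}(T)$: $\sum_{V\in\mathcal{R}(T)}\sum_{P\in\mathcal{P}(V):\,R\in P}y_{V,P}=\sum_{P\in\mathcal{P}(R)}y_{R,P}+x_R$ if $R\in\mathcal{M}(T)$, and $=\sum_{P\in\mathcal{P}(R)}y_{R,P}$ otherwise. -}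

module Defs where

open import Data.Nat using (ℕ; zero; suc; _+_)
open import Data.Bool using (Bool; true; false; _∧_; _∨_; not; if_then_else_)
open import Data.Fin using (Fin; zero; suc)
open import Data.Vec using (Vec; []; _∷_; lookup)
open import Data.Fin.Subset using (Subset; ⊤; _∪_; _∩_)
open import Data.Product using (Σ; _×_; _,_; proj₁; proj₂; ∃)
open import Data.List using (List; []; _∷_; _++_)
open import Data.List.Membership.Propositional using (_∈_)
open import Relation.Binary.PropositionalEquality using (_≡_)

-- Finite sets X, Y, Z are modelled as Fin a, Fin b, Fin c.
-- A relation T ⊆ X × Y × Z is given by its characteristic function.

Rel3 : ℕ → ℕ → ℕ → Set
Rel3 a b c = Fin a → Fin b → Fin c → Bool

anyFin : ∀ n → (Fin n → Bool) → Bool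
anyFin zero    p = false
anyFin (suc n) p = p zero ∨ anyFin n (λ i → p (suc i))

allFin : ∀ n → (Fin n → Bool) → Bool
allFin zero    p = true
allFin (suc n) p = p zero ∧ allFin n (λ i → p (suc i))

_⇒ᵇ_ : Bool → Bool → Bool
u ⇒ᵇ v = not u ∨ v

eqSub : ∀ {n} → Subset n → Subset n → Bool
eqSub []       []       = true
eqSub (u ∷ us) (v ∷ vs) = ((u ∧ v) ∨ (not u ∧ not v)) ∧ eqSub us vs

nonemptyᵇ : ∀ {n} → Subset n → Bool
nonemptyᵇ []       = false
nonemptyᵇ (u ∷ us) = u ∨ nonemptyᵇ us

disjSub : ∀ {n} → Subset n → Subset n → Bool
disjSub s t = not (nonemptyᵇ (s ∩ t))

headIn : ∀ {n} → Subset n → Subset n → Bool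
headIn []          []       = false
headIn (true ∷ s)  (v ∷ t)  = v
headIn (false ∷ s) (_ ∷ t)  = headIn s t

sumSub : ∀ n → (Subset n → ℕ) → ℕ
sumSub zero    f = f []
sumSub (suc n) f = sumSub n (λ s → f (true ∷ s)) + sumSub n (λ s → f (false ∷ s))

Cand : ℕ → ℕ → Set
Cand a b = Subset a × Subset b

isRect : ∀ {a b} → Cand a b → Bool
isRect (X' , Y') = nonemptyᵇ X' ∧ nonemptyᵇ Y'

eqRect : ∀ {a b} → Cand a b → Cand a b → Bool
eqRect (X1 , Y1) (X2 , Y2) = eqSub X1 X2 ∧ eqSub Y1 Y2

fullRect : ∀ {a b} → Cand a b
fullRect = ⊤ , ⊤

cellIn : ∀ {a b} → Fin a → Fin b → Cand a b → Bool
cellIn i j (X' , Y') = lookup X' i ∧ lookup Y' j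

isMono : ∀ {a b c} → Rel3 a b c → Cand a b → Bool
isMono {a} {b} {c} T (X' , Y') =
  anyFin c (λ z → allFin a (λ i → allFin b (λ j →
    (lookup X' i ∧ lookup Y' j) ⇒ᵇ T i j z)))

sumRect : ∀ a b → (Cand a b → ℕ) → ℕ
sumRect a b f = sumSub a (λ X' → sumSub b (λ Y' →
  if isRect (X' , Y') then f (X' , Y') else 0))

isPart : ∀ {a b} → Cand a b → Cand a b → Cand a b → Bool
isPart (X' , Y') (X1 , Y1) (X2 , Y2) =
  isRect (X1 , Y1) ∧ isRect (X2 , Y2) ∧
  ( (eqSub Y1 Y' ∧ eqSub Y2 Y' ∧ eqSub (X1 ∪ X2) X' ∧ disjSub X1 X2)
  ∨ (eqSub X1 X' ∧ eqSub X2 X' ∧ eqSub (Y1 ∪ Y2) Y' ∧ disjSub Y1 Y2))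

-- An unordered partition {W1 , W2} ∈ 𝒫(V) is represented by the unique
-- ordered pair (W1 , W2) in which W1 contains the "corner" cell of V
-- (least row of V, least column of V).
cornerIn : ∀ {a b} → Cand a b → Cand a b → Bool
cornerIn (X' , Y') (X1 , Y1) = headIn X' X1 ∧ headIn Y' Y1

-- (V , W1 , W2) represents an element (V , {W1 , W2}) of Γ(T)
isGamma : ∀ {a b} → Cand a b → Cand a b → Cand a b → Bool
isGamma V W1 W2 = isRect V ∧ isPart V W1 W2 ∧ cornerIn V W1

data PTree {a b : ℕ} : Cand a b → Set where
  leaf : (R : Cand a b) → PTree R
  node : {R : Cand a b} (R1 R2 : Cand a b) → isPart R R1 R2 ≡ true →
         PTree R1 → PTree R2 → PTree R

leaves : ∀ {a b} {R : Cand a b} → PTree R → List (Cand a b)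
leaves (leaf R)          = R ∷ []
leaves (node _ _ _ t u)  = leaves t ++ leaves u

RecPartitions : ∀ {a b} → (Cand a b → Bool) → Set
RecPartitions {a} {b} M' =
  ((R : Cand a b) → M' R ≡ true → isRect R ≡ true)
  × ((R S : Cand a b) → M' R ≡ true → M' S ≡ true → eqRect R S ≡ false →
      (i : Fin a) (j : Fin b) → (cellIn i j R ∧ cellIn i j S) ≡ false)
  × ((i : Fin a) (j : Fin b) → Σ (Cand a b) λ R → M' R ≡ true × cellIn i j R ≡ true)
  × (Σ (PTree fullRect) λ t → (R : Cand a b) →
       (M' R ≡ true → R ∈ leaves t) × (R ∈ leaves t → M' R ≡ true))

-- The integer program PN(T): constraints (i) and (ii)
-- x : 𝓜(T) → ℕ is given as a function on candidates (only values on
-- monochromatic rectangles are used); y : Γ(T) → ℕ is given as a function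
-- on triples (V , W1 , W2) (only values where isGamma holds are used).

ConstraintI : ∀ {a b c} → Rel3 a b c → (Cand a b → ℕ) → Set
ConstraintI {a} {b} T x = (i : Fin a) (j : Fin b) →
  sumRect a b (λ R → if isMono T R ∧ cellIn i j R then x R else 0) ≡ 1

ConstraintII : ∀ {a b c} → Rel3 a b c → (Cand a b → ℕ) →
               (Cand a b → Cand a b → Cand a b → ℕ) → Set
ConstraintII {a} {b} T x y = (R : Cand a b) → isRect R ≡ true →
  eqRect R fullRect ≡ false →
  sumRect a b (λ V → sumRect a b (λ W1 → sumRect a b (λ W2 →
      if isGamma V W1 W2 ∧ (eqRect R W1 ∨ eqRect R W2) then y V W1 W2 else 0)))
  ≡ sumRect a b (λ W1 → sumRect a b (λ W2 →
      if isGamma R W1 W2 then y R W1 W2 else 0))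
    + (if isMono T R then x R else 0)

module Submission where

-- Fix the binary tree t witnessing that 𝓜' recursively partitions C_T.
-- Every internal vertex of t, with rectangle V and children W1, W2, gives a
-- point (V , {W1 , W2}) of Γ(T); y counts how often each point occurs.
--
-- (i)  The members of 𝓜' are pairwise disjoint and cover every cell, so for a
--      cell c exactly one monochromatic rectangle containing c has x_R = 1.
-- (ii) For any tree with root Q and any rectangle R we have flow conservation
--        #(vertices with R as a child) + [R = Q]
--          = #(vertices with R as parent) + #(leaves equal to R),
--      proved by induction on the tree.  For R ≠ C_T the left side is the
--      left side of (ii) and the first term on the right is Σ_P y_{R,P}.  The
--      leaves of t are exactly 𝓜', each occurring once because the leaves of
--      a tree partition the cells of its root; hence #(leaves equal to R) = x_R.

open import Defs
open import Data.Nat using (ℕ; zero; suc; _+_; _≤_; z≤n)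
open import Data.Nat.Properties using (+-identityʳ; +-assoc; ≤-refl; ≤-trans; ≤-reflexive; +-mono-≤; ≤-antisym; m≤m+n; m≤n+m)
open import Data.Bool using (Bool; true; false; if_then_else_; _∧_; _∨_)
open import Data.Bool.Properties using (∨-comm; ∨-zeroʳ; ∧-zeroʳ; ∧-identityʳ)
open import Data.Fin using (Fin; zero; suc)
open import Data.Vec using ([]; _∷_; lookup)
open import Data.Fin.Subset using (Subset; ⊤; _∪_)
open import Data.Fin.Subset.Properties using (∪-comm; ∩-comm; ∩-idem)
open import Data.Product using (Σ; _×_; _,_; proj₁; proj₂)
open import Data.Sum using (_⊎_; inj₁; inj₂)
open import Data.Empty using (⊥; ⊥-elim)
open import Data.List using (List; []; _∷_; _++_)
open import Data.List.Membership.Propositional using (_∈_; _∉_)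
open import Data.List.Relation.Unary.Any using (here; there)
open import Data.List.Relation.Unary.All as All using (All; []; _∷_)
open import Data.List.Relation.Unary.All.Properties using (++⁺)
open import Relation.Binary.PropositionalEquality using (_≡_; refl; sym; trans; cong; cong₂; subst; module ≡-Reasoning)
open import Data.Nat.Tactic.RingSolver using (solve-∀)

-- The indicator of a Boolean; x_R is [ M' R ] definitionally.
[_] : Bool → ℕ
[ b ] = if b then 1 else 0

∧-split : ∀ {u v} → u ∧ v ≡ true → u ≡ true × v ≡ true
∧-split {true} {true} _ = refl , refl

∨-split : ∀ {u v} → u ∨ v ≡ true → u ≡ true ⊎ v ≡ true
∨-split {true} _ = inj₁ refl
∨-split {false} p = inj₂ p

true≢false : true ≡ false → ⊥
true≢false ()

if-zero : ∀ b {n} → n ≡ 0 → (if b then n else 0) ≡ 0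
if-zero true p = p
if-zero false p = refl

if-+ : ∀ b m n → (if b then m + n else 0) ≡ (if b then m else 0) + (if b then n else 0)
if-+ true m n = refl
if-+ false m n = refl

-- The indicator of a disjunction of exclusive tests is the sum of the
-- indicators; stated for the two shapes arising from row and column cuts.
[∨]∧ : ∀ p q r → p ∧ q ≡ false → [ (p ∨ q) ∧ r ] ≡ [ p ∧ r ] + [ q ∧ r ]
[∨]∧ true true r ()
[∨]∧ true false true _ = refl
[∨]∧ true false false _ = refl
[∨]∧ false q true _ = refl
[∨]∧ false q false _ = refl

∧[∨] : ∀ p q r → q ∧ r ≡ false → [ p ∧ (q ∨ r) ] ≡ [ p ∧ q ] + [ p ∧ r ]
∧[∨] false q r _ = refl
∧[∨] true true true ()
∧[∨] true true false _ = refl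
∧[∨] true false r _ = refl

lsum : {A : Set} → List A → (A → ℕ) → ℕ
lsum [] f = 0
lsum (x ∷ xs) f = f x + lsum xs f

lsum-++ : {A : Set} (xs ys : List A) (f : A → ℕ) → lsum (xs ++ ys) f ≡ lsum xs f + lsum ys f
lsum-++ [] ys f = refl
lsum-++ (x ∷ xs) ys f = trans (cong (f x +_) (lsum-++ xs ys f)) (sym (+-assoc (f x) _ _))

lsum-cong : {A : Set} {xs : List A} {f g : A → ℕ} → All (λ x → f x ≡ g x) xs → lsum xs f ≡ lsum xs g
lsum-cong [] = refl
lsum-cong (p ∷ ps) = cong₂ _+_ p (lsum-cong ps)

lsum-mono : {A : Set} {xs : List A} {f g : A → ℕ} → All (λ x → f x ≤ g x) xs → lsum xs f ≤ lsum xs g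
lsum-mono [] = z≤n
lsum-mono (p ∷ ps) = +-mono-≤ p (lsum-mono ps)

lsum-zero : {A : Set} {xs : List A} {f : A → ℕ} → All (λ x → f x ≡ 0) xs → lsum xs f ≡ 0
lsum-zero [] = refl
lsum-zero (p ∷ ps) = cong₂ _+_ p (lsum-zero ps)

lsum-∈ : {A : Set} {xs : List A} {x : A} (f : A → ℕ) → x ∈ xs → f x ≤ lsum xs f
lsum-∈ {xs = y ∷ ys} f (here refl) = m≤m+n (f y) _
lsum-∈ {xs = y ∷ ys} f (there p) = ≤-trans (lsum-∈ f p) (m≤n+m _ (f y))

if-lsum : {A : Set} (b : Bool) (xs : List A) (h : A → ℕ) →
  (if b then lsum xs h else 0) ≡ lsum xs (λ x → if b then h x else 0)
if-lsum true xs h = refl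
if-lsum false xs h = sym (lsum-zero {xs = xs} (All.tabulate (λ _ → refl)))

sumSub-cong : ∀ n {f g : Subset n → ℕ} → (∀ s → f s ≡ g s) → sumSub n f ≡ sumSub n g
sumSub-cong zero p = p []
sumSub-cong (suc n) p = cong₂ _+_ (sumSub-cong n (λ s → p (true ∷ s))) (sumSub-cong n (λ s → p (false ∷ s)))

sumSub-zero : ∀ n {f : Subset n → ℕ} → (∀ s → f s ≡ 0) → sumSub n f ≡ 0
sumSub-zero zero p = p []
sumSub-zero (suc n) p = cong₂ _+_ (sumSub-zero n (λ s → p (true ∷ s))) (sumSub-zero n (λ s → p (false ∷ s)))

sumSub-+ : ∀ n (f g : Subset n → ℕ) → sumSub n (λ s → f s + g s) ≡ sumSub n f + sumSub n g
sumSub-+ zero f g = refl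
sumSub-+ (suc n) f g =
  trans (cong₂ _+_ (sumSub-+ n (λ s → f (true ∷ s)) (λ s → g (true ∷ s)))
                   (sumSub-+ n (λ s → f (false ∷ s)) (λ s → g (false ∷ s))))
        (interchange (sumSub n (λ s → f (true ∷ s))) (sumSub n (λ s → g (true ∷ s)))
                     (sumSub n (λ s → f (false ∷ s))) (sumSub n (λ s → g (false ∷ s))))
  where
  interchange : ∀ p q r s → (p + q) + (r + s) ≡ (p + r) + (q + s)
  interchange = solve-∀

sumSub-delta : ∀ n (s0 : Subset n) (f : Subset n → ℕ) →
  (∀ s → eqSub s0 s ≡ false → f s ≡ 0) → sumSub n f ≡ f s0
sumSub-delta zero [] f p = refl
sumSub-delta (suc n) (true ∷ s0) f p =
  trans (cong₂ _+_ (sumSub-delta n s0 (λ s → f (true ∷ s)) (λ s → p (true ∷ s)))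
                   (sumSub-zero n (λ s → p (false ∷ s) refl)))
        (+-identityʳ _)
sumSub-delta (suc n) (false ∷ s0) f p =
  cong₂ _+_ (sumSub-zero n (λ s → p (true ∷ s) refl))
            (sumSub-delta n s0 (λ s → f (false ∷ s)) (λ s → p (false ∷ s)))

eqSub-≡ : ∀ {n} (s t : Subset n) → eqSub s t ≡ true → s ≡ t
eqSub-≡ [] [] _ = refl
eqSub-≡ (true ∷ s) (true ∷ t) e = cong (true ∷_) (eqSub-≡ s t e)
eqSub-≡ (false ∷ s) (false ∷ t) e = cong (false ∷_) (eqSub-≡ s t e)
eqSub-≡ (true ∷ s) (false ∷ t) ()
eqSub-≡ (false ∷ s) (true ∷ t) ()

eqSub-refl : ∀ {n} (s : Subset n) → eqSub s s ≡ true
eqSub-refl [] = refl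
eqSub-refl (true ∷ s) = eqSub-refl s
eqSub-refl (false ∷ s) = eqSub-refl s

eqRect-≡ : ∀ {a b} (R S : Cand a b) → eqRect R S ≡ true → R ≡ S
eqRect-≡ (X , Y) (X' , Y') e with ∧-split {eqSub X X'} e
... | ex , ey = cong₂ _,_ (eqSub-≡ X X' ex) (eqSub-≡ Y Y' ey)

eqRect-refl : ∀ {a b} (R : Cand a b) → eqRect R R ≡ true
eqRect-refl (X , Y) rewrite eqSub-refl X | eqSub-refl Y = refl

module RectSums {a b : ℕ} where

  sumRect-cong : {f g : Cand a b → ℕ} → (∀ R → f R ≡ g R) → sumRect a b f ≡ sumRect a b g
  sumRect-cong p = sumSub-cong a (λ X → sumSub-cong b (λ Y →
    cong (λ n → if isRect (X , Y) then n else 0) (p (X , Y))))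

  sumRect-zero : {f : Cand a b → ℕ} → (∀ R → f R ≡ 0) → sumRect a b f ≡ 0
  sumRect-zero p = sumSub-zero a (λ X → sumSub-zero b (λ Y → if-zero (isRect (X , Y)) (p (X , Y))))

  sumRect-+ : (f g : Cand a b → ℕ) → sumRect a b (λ R → f R + g R) ≡ sumRect a b f + sumRect a b g
  sumRect-+ f g =
    trans (sumSub-cong a (λ X →
             trans (sumSub-cong b (λ Y → if-+ (isRect (X , Y)) (f (X , Y)) (g (X , Y))))
                   (sumSub-+ b _ _)))
          (sumSub-+ a _ _)

  sumRect-lsum : {A : Set} (xs : List A) (h : A → Cand a b → ℕ) →
    sumRect a b (λ R → lsum xs (λ x → h x R)) ≡ lsum xs (λ x → sumRect a b (h x))
  sumRect-lsum [] h = sumRect-zero (λ R → refl)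
  sumRect-lsum (x ∷ xs) h =
    trans (sumRect-+ (h x) (λ R → lsum xs (λ x → h x R)))
          (cong (sumRect a b (h x) +_) (sumRect-lsum xs h))

  sumRect-delta : (R0 : Cand a b) (f : Cand a b → ℕ) → isRect R0 ≡ true →
    (∀ R → eqRect R0 R ≡ false → f R ≡ 0) → sumRect a b f ≡ f R0
  sumRect-delta (X0 , Y0) f r p =
    trans (sumSub-delta a X0 _ (λ X e → sumSub-zero b (λ Y →
             if-zero (isRect (X , Y)) (p (X , Y) (cong (_∧ eqSub Y0 Y) e)))))
    (trans (sumSub-delta b Y0 _ (λ Y e →
             if-zero (isRect (X0 , Y)) (p (X0 , Y) (trans (cong (eqSub X0 X0 ∧_) e) (∧-zeroʳ _)))))
           (cong (λ c → if c then f (X0 , Y0) else 0) r))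

  -- Triples (V , W1 , W2) index the variables y; the double and triple sums
  -- below are exactly those occurring in constraint (ii).
  Tri : Set
  Tri = Cand a b × Cand a b × Cand a b

  at : {A : Set} → (Cand a b → Cand a b → Cand a b → A) → Tri → A
  at f (V , W1 , W2) = f V W1 W2

  sumPair : (Cand a b → Cand a b → ℕ) → ℕ
  sumPair f = sumRect a b (λ A → sumRect a b (λ B → f A B))

  sumTri : (Cand a b → Cand a b → Cand a b → ℕ) → ℕ
  sumTri f = sumRect a b (λ V → sumPair (f V))

  sumPair-cong : {f g : Cand a b → Cand a b → ℕ} → (∀ A B → f A B ≡ g A B) → sumPair f ≡ sumPair g
  sumPair-cong p = sumRect-cong (λ A → sumRect-cong (p A))

  sumTri-cong : {f g : Cand a b → Cand a b → Cand a b → ℕ} →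
    (∀ V A B → f V A B ≡ g V A B) → sumTri f ≡ sumTri g
  sumTri-cong p = sumRect-cong (λ V → sumPair-cong (p V))

  sumTri-lsum : {A : Set} (xs : List A) (h : A → Cand a b → Cand a b → Cand a b → ℕ) →
    sumTri (λ V W1 W2 → lsum xs (λ x → h x V W1 W2)) ≡ lsum xs (λ x → sumTri (h x))
  sumTri-lsum xs h =
    trans (sumRect-cong (λ V →
             trans (sumRect-cong (λ A → sumRect-lsum xs (λ x → h x V A)))
                   (sumRect-lsum xs (λ x A → sumRect a b (h x V A)))))
          (sumRect-lsum xs (λ x V → sumPair (h x V)))

  eqTri : Tri → Cand a b → Cand a b → Cand a b → Bool
  eqTri (V0 , A0 , B0) V A B = eqRect V0 V ∧ (eqRect A0 A ∧ eqRect B0 B)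

  eqTri-refl : (n : Tri) → at (eqTri n) n ≡ true
  eqTri-refl (V , A , B) rewrite eqRect-refl V | eqRect-refl A | eqRect-refl B = refl

  sumTri-delta : (n : Tri) (f : Cand a b → Cand a b → Cand a b → ℕ) →
    at (λ V A B → isRect V ∧ (isRect A ∧ isRect B)) n ≡ true →
    (∀ V A B → eqTri n V A B ≡ false → f V A B ≡ 0) → sumTri f ≡ at f n
  sumTri-delta (V0 , A0 , B0) f r p with ∧-split {isRect V0} r
  ... | rV , rAB with ∧-split {isRect A0} rAB
  ... | rA , rB =
    trans (sumRect-delta V0 _ rV (λ V e → sumRect-zero (λ A → sumRect-zero (λ B →
             p V A B (cong (_∧ _) e)))))
    (trans (sumRect-delta A0 _ rA (λ A e → sumRect-zero (λ B →
             p V0 A B (trans (cong (λ c → c ∧ (eqRect A0 A ∧ eqRect B0 B)) (eqRect-refl V0))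
                             (cong (_∧ _) e)))))
           (sumRect-delta B0 _ rB (λ B e →
             p V0 A0 B (trans (cong₂ (λ c d → c ∧ (d ∧ eqRect B0 B)) (eqRect-refl V0) (eqRect-refl A0)) e))))

  sumTri-indicator : (n : Tri) (P : Cand a b → Cand a b → Cand a b → Bool) →
    at (λ V A B → isRect V ∧ (isRect A ∧ isRect B)) n ≡ true →
    sumTri (λ V A B → if P V A B then [ eqTri n V A B ] else 0) ≡ [ at P n ]
  sumTri-indicator n P r =
    trans (sumTri-delta n _ r (λ V A B e → if-zero (P V A B) (cong [_] e)))
          (guard (at P n) (eqTri-refl n))
    where
    guard : ∀ c {d} → d ≡ true → (if c then [ d ] else 0) ≡ [ c ]
    guard true refl = refl
    guard false _ = refl

lookup-∪ : ∀ {n} (s t : Subset n) i → lookup (s ∪ t) i ≡ lookup s i ∨ lookup t i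
lookup-∪ (u ∷ s) (v ∷ t) zero = refl
lookup-∪ (u ∷ s) (v ∷ t) (suc i) = lookup-∪ s t i

lookup-⊤ : ∀ {n} (i : Fin n) → lookup ⊤ i ≡ true
lookup-⊤ zero = refl
lookup-⊤ (suc i) = lookup-⊤ i

disj-lookup : ∀ {n} (s t : Subset n) i → disjSub s t ≡ true → lookup s i ∧ lookup t i ≡ false
disj-lookup (true ∷ s) (true ∷ t) i ()
disj-lookup (true ∷ s) (false ∷ t) zero e = refl
disj-lookup (false ∷ s) (v ∷ t) zero e = refl
disj-lookup (true ∷ s) (false ∷ t) (suc i) e = disj-lookup s t i e
disj-lookup (false ∷ s) (v ∷ t) (suc i) e = disj-lookup s t i e

nonempty-witness : ∀ {n} (s : Subset n) → nonemptyᵇ s ≡ true → Σ (Fin n) λ i → lookup s i ≡ true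
nonempty-witness (true ∷ s) e = zero , refl
nonempty-witness (false ∷ s) e with nonempty-witness s e
... | i , p = suc i , p

headIn-self : ∀ {n} (s : Subset n) → nonemptyᵇ s ≡ true → headIn s s ≡ true
headIn-self (true ∷ s) e = refl
headIn-self (false ∷ s) e = headIn-self s e

headIn-∪ : ∀ {n} (s t : Subset n) → nonemptyᵇ (s ∪ t) ≡ true → headIn (s ∪ t) s ∨ headIn (s ∪ t) t ≡ true
headIn-∪ [] [] ()
headIn-∪ (true ∷ s) (v ∷ t) e = refl
headIn-∪ (false ∷ s) (true ∷ t) e = refl
headIn-∪ (false ∷ s) (false ∷ t) e = headIn-∪ s t e

disj-self : ∀ {n} (s : Subset n) → nonemptyᵇ s ≡ true → disjSub s s ≡ false
disj-self s e rewrite ∩-idem s | e = refl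

disj-comm : ∀ {n} (s t : Subset n) → disjSub s t ≡ disjSub t s
disj-comm s t rewrite ∩-comm s t = refl

rect-cell : ∀ {a b} (R : Cand a b) → isRect R ≡ true → Σ (Fin a) λ i → Σ (Fin b) λ j → cellIn i j R ≡ true
rect-cell (X , Y) r with ∧-split {nonemptyᵇ X} r
... | nX , nY with nonempty-witness X nX | nonempty-witness Y nY
...   | i , pi | j , pj = i , j , cong₂ _∧_ pi pj

full-isRect : ∀ {a b} → Fin a → Fin b → isRect (fullRect {a} {b}) ≡ true
full-isRect zero zero = refl
full-isRect zero (suc j) = refl
full-isRect (suc i) zero = refl
full-isRect (suc i) (suc j) = refl

cell-full : ∀ {a b} (i : Fin a) (j : Fin b) → cellIn i j (fullRect {a} {b}) ≡ true
cell-full i j rewrite lookup-⊤ i | lookup-⊤ j = refl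

data Cut {a b} (X : Subset a) (Y : Subset b) :
         Subset a → Subset b → Subset a → Subset b → Set where
  rowCut : ∀ {X1 X2} → disjSub X1 X2 ≡ true → X1 ∪ X2 ≡ X → Cut X Y X1 Y X2 Y
  colCut : ∀ {Y1 Y2} → disjSub Y1 Y2 ≡ true → Y1 ∪ Y2 ≡ Y → Cut X Y X Y1 X Y2

module Partitions {a b : ℕ} where

  record Decoded (X : Subset a) (Y : Subset b) (X1 : Subset a) (Y1 : Subset b)
                 (X2 : Subset a) (Y2 : Subset b) : Set where
    field
      rect₁ : isRect (X1 , Y1) ≡ true
      rect₂ : isRect (X2 , Y2) ≡ true
      cut   : Cut X Y X1 Y1 X2 Y2

  decode : ∀ X Y X1 Y1 X2 Y2 → isPart (X , Y) (X1 , Y1) (X2 , Y2) ≡ true → Decoded X Y X1 Y1 X2 Y2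
  decode X Y X1 Y1 X2 Y2 e with ∧-split {isRect (X1 , Y1)} e
  ... | r1 , e' with ∧-split {isRect (X2 , Y2)} e'
  ... | r2 , e'' with ∨-split e''
  ... | inj₁ p with ∧-split {eqSub Y1 Y} p
  ...   | p1 , q1 with ∧-split {eqSub Y2 Y} q1
  ...   | p2 , q2 with ∧-split {eqSub (X1 ∪ X2) X} q2
  ...   | p3 , d with eqSub-≡ Y1 Y p1 | eqSub-≡ Y2 Y p2
  ...   | refl | refl = record { rect₁ = r1 ; rect₂ = r2 ; cut = rowCut d (eqSub-≡ _ _ p3) }
  decode X Y X1 Y1 X2 Y2 e | r1 , _ | r2 , _ | inj₂ p with ∧-split {eqSub X1 X} p
  ...   | p1 , q1 with ∧-split {eqSub X2 X} q1
  ...   | p2 , q2 with ∧-split {eqSub (Y1 ∪ Y2) Y} q2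
  ...   | p3 , d with eqSub-≡ X1 X p1 | eqSub-≡ X2 X p2
  ...   | refl | refl = record { rect₁ = r1 ; rect₂ = r2 ; cut = colCut d (eqSub-≡ _ _ p3) }

  parts-rect : (Q R1 R2 : Cand a b) → isPart Q R1 R2 ≡ true → isRect R1 ≡ true × isRect R2 ≡ true
  parts-rect (X , Y) (X1 , Y1) (X2 , Y2) e =
    Decoded.rect₁ (decode X Y X1 Y1 X2 Y2 e) , Decoded.rect₂ (decode X Y X1 Y1 X2 Y2 e)

  cell-split : (Q R1 R2 : Cand a b) → isPart Q R1 R2 ≡ true → (i : Fin a) (j : Fin b) →
    [ cellIn i j Q ] ≡ [ cellIn i j R1 ] + [ cellIn i j R2 ]
  cell-split (X , Y) (X1 , Y1) (X2 , Y2) e i j with Decoded.cut (decode X Y X1 Y1 X2 Y2 e)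
  ... | rowCut d refl rewrite lookup-∪ X1 X2 i = [∨]∧ (lookup X1 i) (lookup X2 i) (lookup Y j) (disj-lookup X1 X2 i d)
  ... | colCut d refl rewrite lookup-∪ Y1 Y2 j = ∧[∨] (lookup X i) (lookup Y1 j) (lookup Y2 j) (disj-lookup Y1 Y2 j d)

  isPart-sym : (Q R1 R2 : Cand a b) → isPart Q R1 R2 ≡ true → isPart Q R2 R1 ≡ true
  isPart-sym (X , Y) (X1 , Y1) (X2 , Y2) e with decode X Y X1 Y1 X2 Y2 e
  ... | record { rect₁ = r1 ; rect₂ = r2 ; cut = rowCut d refl }
    rewrite r1 | r2 | eqSub-refl Y | ∪-comm X2 X1 | eqSub-refl (X1 ∪ X2) | disj-comm X2 X1 | d = refl
  ... | record { rect₁ = r1 ; rect₂ = r2 ; cut = colCut d refl }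
    rewrite r1 | r2 | eqSub-refl X | ∪-comm Y2 Y1 | eqSub-refl (Y1 ∪ Y2) | disj-comm Y2 Y1 | d = ∨-zeroʳ _

  corner-in-other : (Q R1 R2 : Cand a b) → isPart Q R1 R2 ≡ true → isRect Q ≡ true →
    cornerIn Q R1 ≡ false → cornerIn Q R2 ≡ true
  corner-in-other (X , Y) (X1 , Y1) (X2 , Y2) e rQ c with Decoded.cut (decode X Y X1 Y1 X2 Y2 e)
  ... | rowCut d refl with ∧-split {nonemptyᵇ (X1 ∪ X2)} rQ
  ...   | nX , nY rewrite headIn-self Y nY with headIn (X1 ∪ X2) X1 in h1 | ∨-split (headIn-∪ X1 X2 nX)
  ...     | true | _ = ⊥-elim (true≢false (trans (cong (_∧ true) (sym h1)) c))
  ...     | false | inj₁ p = ⊥-elim (true≢false (trans (sym p) h1))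
  ...     | false | inj₂ p rewrite p = refl
  corner-in-other (X , Y) (X1 , Y1) (X2 , Y2) e rQ c | colCut d refl with ∧-split {nonemptyᵇ X} rQ
  ...   | nX , nY rewrite headIn-self X nX with headIn (Y1 ∪ Y2) Y1 in h1 | ∨-split (headIn-∪ Y1 Y2 nY)
  ...     | true | _ = ⊥-elim (true≢false (trans (sym h1) c))
  ...     | false | inj₁ p = ⊥-elim (true≢false (trans (sym p) h1))
  ...     | false | inj₂ p = p

  parts-distinct : (Q R : Cand a b) → isPart Q R R ≡ true → ⊥
  parts-distinct (X , Y) (X1 , Y1) e with decode X Y X1 Y1 X1 Y1 e
  ... | record { rect₁ = r1 ; cut = rowCut d _ } =
    true≢false (trans (sym d) (disj-self X1 (proj₁ (∧-split {nonemptyᵇ X1} r1))))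
  ... | record { rect₁ = r1 ; cut = colCut d _ } =
    true≢false (trans (sym d) (disj-self Y1 (proj₂ (∧-split {nonemptyᵇ X1} r1))))

  -- A rectangle equals at most one part, so "R is a part" counts once.
  [is-part] : (Q R1 R2 R : Cand a b) → isPart Q R1 R2 ≡ true →
    [ eqRect R R1 ∨ eqRect R R2 ] ≡ [ eqRect R R1 ] + [ eqRect R R2 ]
  [is-part] Q R1 R2 R p with eqRect R R1 in e1 | eqRect R R2 in e2
  ... | true | true with eqRect-≡ R R1 e1 | eqRect-≡ R R2 e2
  ...   | refl | refl = ⊥-elim (parts-distinct Q R p)
  [is-part] Q R1 R2 R p | true | false = refl
  [is-part] Q R1 R2 R p | false | true = refl
  [is-part] Q R1 R2 R p | false | false = refl

-- Trees of partitions and their invariants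

module Trees {a b : ℕ} where
  open RectSums {a} {b}
  open Partitions {a} {b}

  -- The point of Γ(T) given by a partition {R1 , R2} of Q: the pair is
  -- ordered so that the first part contains the corner of Q.
  orient : Bool → Cand a b → Cand a b → Cand a b → Tri
  orient true Q R1 R2 = Q , R1 , R2
  orient false Q R1 R2 = Q , R2 , R1

  gammaPoint : Cand a b → Cand a b → Cand a b → Tri
  gammaPoint Q R1 R2 = orient (cornerIn Q R1) Q R1 R2

  gammaPoint-valid : (Q R1 R2 : Cand a b) → isPart Q R1 R2 ≡ true → isRect Q ≡ true →
    at isGamma (gammaPoint Q R1 R2) ≡ true
  gammaPoint-valid Q R1 R2 p rQ with cornerIn Q R1 in c
  ... | true rewrite rQ | p | c = refl
  ... | false rewrite rQ | isPart-sym Q R1 R2 p | corner-in-other Q R1 R2 p rQ c = refl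

  gamma-rects : (n : Tri) → at isGamma n ≡ true → at (λ V A B → isRect V ∧ (isRect A ∧ isRect B)) n ≡ true
  gamma-rects (V , A , B) g with ∧-split {isRect V} g
  ... | rV , g' with parts-rect V A B (proj₁ (∧-split {isPart V A B} g'))
  ...   | rA , rB rewrite rV | rA | rB = refl

  -- The multiset of points of Γ(T) at the internal vertices of a tree.
  vertices : {Q : Cand a b} → PTree Q → List Tri
  vertices (leaf R) = []
  vertices {Q} (node R1 R2 p t u) = gammaPoint Q R1 R2 ∷ (vertices t ++ vertices u)

  vertices-valid : {Q : Cand a b} (t : PTree Q) → isRect Q ≡ true → All (λ n → at isGamma n ≡ true) (vertices t)
  vertices-valid (leaf R) rQ = []
  vertices-valid {Q} (node R1 R2 p t u) rQ =
    gammaPoint-valid Q R1 R2 p rQ ∷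
      ++⁺ (vertices-valid t (proj₁ (parts-rect Q R1 R2 p))) (vertices-valid u (proj₂ (parts-rect Q R1 R2 p)))

  leaves-cover : {Q : Cand a b} (t : PTree Q) (i : Fin a) (j : Fin b) →
    lsum (leaves t) (λ L → [ cellIn i j L ]) ≡ [ cellIn i j Q ]
  leaves-cover (leaf R) i j = +-identityʳ _
  leaves-cover {Q} (node R1 R2 p t u) i j =
    trans (lsum-++ (leaves t) (leaves u) _)
      (trans (cong₂ _+_ (leaves-cover t i j) (leaves-cover u i j)) (sym (cell-split Q R1 R2 p i j)))

  asChild : Cand a b → Tri → ℕ
  asChild R = at (λ V A B → [ eqRect R A ∨ eqRect R B ])

  asParent : Cand a b → Tri → ℕ
  asParent R = at (λ V A B → [ eqRect R V ])

  asLeaf : Cand a b → Cand a b → ℕ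
  asLeaf R L = [ eqRect R L ]

  asChild-gammaPoint : (Q R1 R2 R : Cand a b) → isPart Q R1 R2 ≡ true →
    asChild R (gammaPoint Q R1 R2) ≡ [ eqRect R R1 ] + [ eqRect R R2 ]
  asChild-gammaPoint Q R1 R2 R p with cornerIn Q R1
  ... | true = [is-part] Q R1 R2 R p
  ... | false = trans (cong [_] (∨-comm (eqRect R R2) (eqRect R R1))) ([is-part] Q R1 R2 R p)

  asParent-gammaPoint : (Q R1 R2 R : Cand a b) → asParent R (gammaPoint Q R1 R2) ≡ [ eqRect R Q ]
  asParent-gammaPoint Q R1 R2 R with cornerIn Q R1
  ... | true = refl
  ... | false = refl

  -- Flow conservation: every occurrence of R as a child or as the root is an
  -- occurrence as a parent or as a leaf.
  conservation : {Q : Cand a b} (t : PTree Q) (R : Cand a b) →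
    lsum (vertices t) (asChild R) + [ eqRect R Q ] ≡ lsum (vertices t) (asParent R) + lsum (leaves t) (asLeaf R)
  conservation (leaf Q) R = sym (+-identityʳ _)
  conservation {Q} (node R1 R2 p t u) R = begin
      (asChild R (gammaPoint Q R1 R2) + lsum (vertices t ++ vertices u) (asChild R)) + q
        ≡⟨ cong₂ (λ k m → (k + m) + q) (asChild-gammaPoint Q R1 R2 R p) (lsum-++ (vertices t) (vertices u) _) ⟩
      ([ eqRect R R1 ] + [ eqRect R R2 ]) + (ct + cu) + q
        ≡⟨ regroup [ eqRect R R1 ] [ eqRect R R2 ] ct cu q ⟩
      q + ((ct + [ eqRect R R1 ]) + (cu + [ eqRect R R2 ]))
        ≡⟨ cong (q +_) (cong₂ _+_ (conservation t R) (conservation u R)) ⟩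
      q + ((pt + lt) + (pu + lu))
        ≡⟨ regroup′ q pt lt pu lu ⟩
      (q + (pt + pu)) + (lt + lu)
        ≡⟨ sym (cong₂ (λ k m → (k + m) + (lt + lu)) (asParent-gammaPoint Q R1 R2 R) (lsum-++ (vertices t) (vertices u) _)) ⟩
      (asParent R (gammaPoint Q R1 R2) + lsum (vertices t ++ vertices u) (asParent R)) + (lt + lu)
        ≡⟨ cong ((asParent R (gammaPoint Q R1 R2) + lsum (vertices t ++ vertices u) (asParent R)) +_)
                (sym (lsum-++ (leaves t) (leaves u) (asLeaf R))) ⟩
      (asParent R (gammaPoint Q R1 R2) + lsum (vertices t ++ vertices u) (asParent R)) + lsum (leaves t ++ leaves u) (asLeaf R)
    ∎
    where
    open ≡-Reasoning
    q = [ eqRect R Q ]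
    ct = lsum (vertices t) (asChild R)
    cu = lsum (vertices u) (asChild R)
    pt = lsum (vertices t) (asParent R)
    pu = lsum (vertices u) (asParent R)
    lt = lsum (leaves t) (asLeaf R)
    lu = lsum (leaves u) (asLeaf R)
    regroup : ∀ e1 e2 c1 c2 q → (e1 + e2) + (c1 + c2) + q ≡ q + ((c1 + e1) + (c2 + e2))
    regroup = solve-∀
    regroup′ : ∀ q p1 l1 p2 l2 → q + ((p1 + l1) + (p2 + l2)) ≡ (q + (p1 + p2)) + (l1 + l2)
    regroup′ = solve-∀

  asLeaf-≤1 : {Q : Cand a b} (t : PTree Q) (R : Cand a b) (i : Fin a) (j : Fin b) →
    cellIn i j R ≡ true → cellIn i j Q ≡ true → lsum (leaves t) (asLeaf R) ≤ 1
  asLeaf-≤1 {Q} t R i j cR cQ =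
    ≤-trans (lsum-mono {xs = leaves t} (All.tabulate (λ {L} _ → below L)))
            (≤-reflexive (trans (leaves-cover t i j) (cong [_] cQ)))
    where
    below : ∀ L → asLeaf R L ≤ [ cellIn i j L ]
    below L with eqRect R L in e
    ... | false = z≤n
    ... | true with eqRect-≡ R L e
    ...   | refl rewrite cR = ≤-refl

  asLeaf-∉ : {Q : Cand a b} (t : PTree Q) (R : Cand a b) → R ∉ leaves t → lsum (leaves t) (asLeaf R) ≡ 0
  asLeaf-∉ t R R∉ = lsum-zero (All.tabulate (λ {L} L∈ → not-leaf L L∈))
    where
    not-leaf : ∀ L → L ∈ leaves t → asLeaf R L ≡ 0
    not-leaf L L∈ with eqRect R L in e
    ... | false = refl
    ... | true with eqRect-≡ R L e
    ...   | refl = ⊥-elim (R∉ L∈)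

  asLeaf-indicator : (t : PTree (fullRect {a} {b})) (M' : Cand a b → Bool) →
    ((R : Cand a b) → M' R ≡ true → isRect R ≡ true) →
    ((R : Cand a b) → (M' R ≡ true → R ∈ leaves t) × (R ∈ leaves t → M' R ≡ true)) →
    (R : Cand a b) → lsum (leaves t) (asLeaf R) ≡ [ M' R ]
  asLeaf-indicator t M' rects leaf⇔ R with M' R in e
  ... | true with rect-cell R (rects R e)
  ...   | i , j , cR = ≤-antisym (asLeaf-≤1 t R i j cR (cell-full i j))
                          (subst (λ c → [ c ] ≤ lsum (leaves t) (asLeaf R)) (eqRect-refl R) (lsum-∈ (asLeaf R) (proj₁ (leaf⇔ R) e)))
  asLeaf-indicator t M' rects leaf⇔ R | false =
    asLeaf-∉ t R (λ R∈ → true≢false (trans (sym (proj₂ (leaf⇔ R) R∈)) e))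

-- The two constraints

module Constraints {a b c : ℕ} (T : Rel3 a b c) where
  open RectSums {a} {b}
  open Trees {a} {b}

  -- (i) holds for the indicator of any set of pairwise disjoint
  -- monochromatic rectangles covering every cell: the cover of a cell is the
  -- only member containing it.
  indicator-constraintI : (M' : Cand a b → Bool) →
    ((R : Cand a b) → M' R ≡ true → isMono T R ≡ true) →
    ((R : Cand a b) → M' R ≡ true → isRect R ≡ true) →
    ((R S : Cand a b) → M' R ≡ true → M' S ≡ true → eqRect R S ≡ false →
      (i : Fin a) (j : Fin b) → (cellIn i j R ∧ cellIn i j S) ≡ false) →
    ((i : Fin a) (j : Fin b) → Σ (Cand a b) λ R → M' R ≡ true × cellIn i j R ≡ true) →
    ConstraintI T (λ R → [ M' R ])
  indicator-constraintI M' mono rects disjoint cover i j with cover i j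
  ... | R0 , m0 , c0 = trans (sumRect-delta R0 _ (rects R0 m0) only-R0) at-R0
    where
    only-R0 : ∀ R → eqRect R0 R ≡ false → (if isMono T R ∧ cellIn i j R then [ M' R ] else 0) ≡ 0
    only-R0 R e with M' R in mR
    ... | false = if-zero (isMono T R ∧ cellIn i j R) refl
    ... | true with cellIn i j R in cR
    ...   | false rewrite ∧-zeroʳ (isMono T R) = refl
    ...   | true = ⊥-elim (true≢false (trans (sym (cong₂ _∧_ c0 cR)) (disjoint R0 R m0 mR e i j)))
    at-R0 : (if isMono T R0 ∧ cellIn i j R0 then [ M' R0 ] else 0) ≡ 1
    at-R0 rewrite mono R0 m0 | c0 | m0 = refl

  -- y counts the vertices of a tree at each point of Γ(T).
  count : List Tri → Cand a b → Cand a b → Cand a b → ℕ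
  count N V A B = lsum N (λ n → [ eqTri n V A B ])

  sum-count : (N : List Tri) → All (λ n → at isGamma n ≡ true) N →
    (P : Cand a b → Cand a b → Cand a b → Bool) →
    sumTri (λ V A B → if isGamma V A B ∧ P V A B then count N V A B else 0) ≡ lsum N (λ n → [ at P n ])
  sum-count N valid P =
    trans (sumTri-cong (λ V A B → if-lsum (isGamma V A B ∧ P V A B) N (λ n → [ eqTri n V A B ])))
    (trans (sumTri-lsum N (λ n V A B → if isGamma V A B ∧ P V A B then [ eqTri n V A B ] else 0))
           (lsum-cong (All.map (λ {n} g → trans (sumTri-indicator n (λ V A B → isGamma V A B ∧ P V A B) (gamma-rects n g))
                                                 (cong (λ d → [ d ∧ at P n ]) g)) valid)))

  parent-sum : (R : Cand a b) → isRect R ≡ true → (y : Cand a b → Cand a b → Cand a b → ℕ) →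
    sumPair (λ A B → if isGamma R A B then y R A B else 0)
    ≡ sumTri (λ V A B → if isGamma V A B ∧ eqRect R V then y V A B else 0)
  parent-sum R rR y = sym (trans (sumRect-delta R _ rR off-R) at-R)
    where
    off-R : ∀ V → eqRect R V ≡ false → sumPair (λ A B → if isGamma V A B ∧ eqRect R V then y V A B else 0) ≡ 0
    off-R V e = sumRect-zero (λ A → sumRect-zero (λ B →
      cong (λ d → if d then y V A B else 0) (trans (cong (isGamma V A B ∧_) e) (∧-zeroʳ _))))
    at-R : sumPair (λ A B → if isGamma R A B ∧ eqRect R R then y R A B else 0)
           ≡ sumPair (λ A B → if isGamma R A B then y R A B else 0)
    at-R = sumPair-cong (λ A B → cong (λ d → if d then y R A B else 0)
                                       (trans (cong (isGamma R A B ∧_) (eqRect-refl R)) (∧-identityʳ _)))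

  guarded-indicator : (M' : Cand a b → Bool) → ((R : Cand a b) → M' R ≡ true → isMono T R ≡ true) →
    (R : Cand a b) → (if isMono T R then [ M' R ] else 0) ≡ [ M' R ]
  guarded-indicator M' mono R with M' R in e
  ... | true rewrite mono R e = refl
  ... | false = if-zero (isMono T R) refl

lemma1 : (a b c : ℕ) (T : Rel3 a b c) →
    (Σ (Fin a) λ i → Σ (Fin b) λ j → Σ (Fin c) λ z → T i j z ≡ true) →
    ((i : Fin a) (j : Fin b) → Σ (Fin c) λ z → T i j z ≡ true) →
    (M' : Cand a b → Bool) →
    ((R : Cand a b) → M' R ≡ true → isMono T R ≡ true) →
    RecPartitions M' →
    ConstraintI T (λ R → if M' R then 1 else 0) ×
    Σ (Cand a b → Cand a b → Cand a b → ℕ) λ y →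
    ConstraintII T (λ R → if M' R then 1 else 0) y
lemma1 a b c T (i0 , j0 , _) _ M' mono (rects , disjoint , cover , t , leaf⇔) =
  indicator-constraintI M' mono rects disjoint cover , count N , constraintII
  where
  open RectSums {a} {b}
  open Trees {a} {b}
  open Constraints T
  open ≡-Reasoning

  N : List Tri
  N = vertices t

  valid : All (λ n → at isGamma n ≡ true) N
  valid = vertices-valid t (full-isRect i0 j0)

  constraintII : ConstraintII T (λ R → [ M' R ]) (count N)
  constraintII R rR notFull = begin
    sumTri (λ V A B → if isGamma V A B ∧ (eqRect R A ∨ eqRect R B) then count N V A B else 0)
      ≡⟨ sum-count N valid (λ V A B → eqRect R A ∨ eqRect R B) ⟩
    lsum N (asChild R)
      ≡⟨ sym (trans (cong (λ d → lsum N (asChild R) + [ d ]) notFull) (+-identityʳ _)) ⟩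
    lsum N (asChild R) + [ eqRect R fullRect ]
      ≡⟨ conservation t R ⟩
    lsum N (asParent R) + lsum (leaves t) (asLeaf R)
      ≡⟨ cong₂ _+_ (sym (trans (parent-sum R rR (count N)) (sum-count N valid (λ V A B → eqRect R V))))
                   (trans (asLeaf-indicator t M' rects leaf⇔ R) (sym (guarded-indicator M' mono R))) ⟩
    sumPair (λ A B → if isGamma R A B then count N R A B else 0) + (if isMono T R then [ M' R ] else 0)
    ∎
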